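{- Let $Q(\bm x)=a_1x_1^2+\dots+a_\ell x_\ell^2$ with nonzero integers $a_j$, let $\bm u\in\mathbb{Z}^\ell$ be primitive with $Q(\bm u)\ne0$, let $k,r\in\mathbb{N}$ and $p$ an odd prime. If $k\ge\max\{d_{\bm u,p},r\}$, then \[ N\left(Q;\bm u,r,p^k\right)\ \ge\ p^{(\ell-1)(k-\max\{d_{\bm u,p},r\})}. \]
   Context: $d_{\bm u,p}=\min_{j:\,p\nmid u_j}(\mathrm{ord}_p(a_j)+1)$ is the depth of $Q$ at $p$ associated to $\bm u$. $N(Q;\bm u,r,p^k)$ (denoted $r(Q;\bm u,r,p^k)$ in the paper) is the number of $\bm x\in\mathbb{Z}_p^\ell/p^k\mathbb{Z}_p^\ell$ with $\bm x\notin p\mathbb{Z}_p^\ell$, $Q(\bm x)\equiv Q(\bm u)\pmod{p^k}$, and $\bm x\equiv\bm u\pmod{p^r}$. -}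

module Defs where

open import Data.Nat as ℕ using (ℕ; zero; suc; _⊔_; _⊓_)
open import Data.Nat.Divisibility using (_∣_; _∣?_)
open import Data.Nat.DivMod using (_/_)
open import Data.Integer as ℤ using (ℤ; +_; ∣_∣)
open import Data.Fin using (Fin)
import Data.Fin as F
import Data.Fin.Properties as FP
open import Data.Fin.Properties using (any?)
open import Data.Vec as Vec using (Vec; []; _∷_; lookup)
open import Data.List as List using (List; []; _∷_; upTo; concatMap; length; filter)
open import Data.Product using (∃; _×_; _,_)
open import Relation.Nullary using (¬_; Dec; yes; no)
open import Relation.Nullary.Decidable using (_×-dec_; ¬?)
open import Relation.Binary.PropositionalEquality using (_≡_)

sumFin : (n : ℕ) → (Fin n → ℤ) → ℤ
sumFin zero f = + 0
sumFin (suc n) f = f F.zero ℤ.+ sumFin n (λ i → f (F.suc i))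

Qform : {ℓ : ℕ} → (Fin ℓ → ℤ) → (Fin ℓ → ℤ) → ℤ
Qform {ℓ} a x = sumFin ℓ (λ j → a j ℤ.* (x j ℤ.* x j))

_≡_[mod_] : ℤ → ℤ → ℕ → Set
x ≡ y [mod m ] = m ∣ ∣ x ℤ.- y ∣

_≡?_[mod_] : (x y : ℤ) (m : ℕ) → Dec (x ≡ y [mod m ])
x ≡? y [mod m ] = m ∣? ∣ x ℤ.- y ∣

Primitive : {ℓ : ℕ} → (Fin ℓ → ℤ) → Set
Primitive {ℓ} u = (d : ℕ) → ((j : Fin ℓ) → d ∣ ∣ u j ∣) → d ≡ 1

-- p-adic valuation of a natural number, computed with fuel
ordAux : ℕ → ℕ → ℕ → ℕ
ordAux zero p n = 0
ordAux (suc f) zero n = 0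
ordAux (suc f) (suc q) zero = 0
ordAux (suc f) (suc q) (suc n) with suc q ∣? suc n
... | yes _ = suc (ordAux f (suc q) (suc n / suc q))
... | no _ = 0

-- ord_p(a) for a nonzero integer a (fuel |a| suffices when p ≥ 2)
ord : ℕ → ℤ → ℕ
ord p a = ordAux (∣ a ∣) p (∣ a ∣)

-- minimum of a list (default 0 for the empty list; never used when u is primitive)
minimum : List ℕ → ℕ
minimum [] = 0
minimum (x ∷ xs) = List.foldr _⊓_ x xs

allFinList : (n : ℕ) → List (Fin n)
allFinList n = List.allFin n

depth : {ℓ : ℕ} → (a u : Fin ℓ → ℤ) → ℕ → ℕ
depth {ℓ} a u p =
  minimum (List.map (λ j → suc (ord p (a j)))
             (filter (λ j → ¬? (p ∣? ∣ u j ∣)) (allFinList ℓ)))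

-- all vectors in {0,…,m-1}^ℓ (representatives of (Z/mZ)^ℓ)
allVecs : (ℓ m : ℕ) → List (Vec ℕ ℓ)
allVecs zero m = [] ∷ []
allVecs (suc ℓ) m = concatMap (λ i → List.map (i ∷_) (allVecs ℓ m)) (upTo m)

toZ : {ℓ : ℕ} → Vec ℕ ℓ → Fin ℓ → ℤ
toZ v j = + (lookup v j)

Cond : {ℓ : ℕ} → (a u : Fin ℓ → ℤ) → (p k r : ℕ) → Vec ℕ ℓ → Set
Cond {ℓ} a u p k r v =
  (∃ λ (j : Fin ℓ) → ¬ (p ∣ ∣ toZ v j ∣))
  × (Qform a (toZ v) ≡ Qform a u [mod p ℕ.^ k ])
  × ((j : Fin ℓ) → toZ v j ≡ u j [mod p ℕ.^ r ])

cond? : {ℓ : ℕ} → (a u : Fin ℓ → ℤ) → (p k r : ℕ) → (v : Vec ℕ ℓ) → Dec (Cond a u p k r v)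
cond? a u p k r v =
  any? (λ j → ¬? (p ∣? ∣ toZ v j ∣))
  ×-dec ((Qform a (toZ v) ≡? Qform a u [mod p ℕ.^ k ])
  ×-dec FP.all? (λ j → toZ v j ≡? u j [mod p ℕ.^ r ]))

N : {ℓ : ℕ} → (a u : Fin ℓ → ℤ) → (r p k : ℕ) → ℕ
N {ℓ} a u r p k = length (filter (cond? a u p k r) (allVecs ℓ (p ℕ.^ k)))

-- Let g be the least p-adic valuation of the products aᵢuᵢ, attained at j. A coordinate
-- j₀ realising the depth d has uⱼ₀ a unit, so g ≤ ord(aⱼ₀) < d ≤ m := max(d, r). Writing
-- aᵢuᵢ = cᵢ p^g, the lift x = u + p^m t satisfies
--   Q(x) − Q(u) = p^(m+g) Σᵢ (2cᵢtᵢ + p^(m−g) aᵢtᵢ²).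
-- Fix the tᵢ with i ≠ j as arbitrary digits modulo p^(k−m); the right-hand side is then a
-- quadratic in t_j with unit linear coefficient 2c_j (p is odd) and quadratic coefficient
-- divisible by p, so Hensel's lemma gives Q(x) ≡ Q(u) modulo p^k. The (p^(k−m))^(ℓ−1) lifts
-- obtained are pairwise incongruent modulo p^k, agree with u modulo p^r, and are primitive.
module Submission where

open import Defs
open import Data.Nat as ℕ using (ℕ; zero; suc; _≤_; _<_; _^_; _⊓_; _⊔_; _∸_; z≤n; s≤s; NonZero)
import Data.Nat.Properties as ℕₚ
open import Data.Nat.Divisibility
  using (_∣_; _∣?_; divides; ∣-trans; 1∣_; m∣m*n; *-monoˡ-∣; *-cancelˡ-∣; ∣⇒≤; >⇒∤)
open import Data.Nat.Primality
  using (Prime; prime⇒irreducible; irreducible[2]; prime⇒nonZero; euclidsLemma; ¬prime[0]; ¬prime[1])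
open import Data.Nat.Coprimality using (Coprime; coprime-Bézout)
open import Data.Nat.GCD using (module Bézout)
open import Data.Nat.DivMod using (_/_; m*[n/m]≡n; m/n<m; m≥n⇒m/n>0)
open import Data.Integer as ℤ using (ℤ; +_; -[1+_]; ∣_∣; _+_; _*_; -_; _-_)
import Data.Integer.Properties as ℤₚ
import Data.Integer.Divisibility.Signed as ℤ∣
open ℤ∣ using (∣ᵤ⇒∣; ∣⇒∣ᵤ) renaming (_∣_ to _∣ᶻ_)
open import Data.Integer.DivMod using (_%ℕ_; _/ℕ_; n%ℕd<d; a≡a%ℕn+[a/ℕn]*n)
open import Data.Integer.Tactic.RingSolver using (solve-∀)
open import Data.Fin as Fin using (Fin; punchIn; toℕ; finToFun; funToFin; combine)
import Data.Fin.Properties as Finₚ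
open import Data.Vec using (Vec; []; _∷_; lookup; tabulate)
import Data.Vec.Properties as Vecₚ
open import Data.Vec.Functional using (insertAt)
open import Data.Vec.Functional.Properties using (insertAt-punchIn)
open import Data.List as List using (List; []; _∷_; length; filter)
open import Data.List.Membership.Propositional using (_∈_)
open import Data.List.Membership.Propositional.Properties
  using (∈-filter⁺; ∈-filter⁻; ∈-map⁺; ∈-map⁻; ∈-concatMap⁺; ∈-upTo⁺; ∈-allFin)
open import Data.List.Relation.Unary.Any as Any using (here; there)
open import Data.List.Relation.Unary.Any.Properties using (lookup-index)
open import Data.Product using (∃; ∃₂; _×_; _,_; proj₁; proj₂)
open import Data.Sum using (inj₁; inj₂)
open import Function using (_∘_)
open import Function.Definitions using (Injective)
open import Relation.Nullary using (¬_; yes; no; contradiction)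
open import Relation.Nullary.Decidable using (¬?)
open import Relation.Unary using (Pred; Decidable)
open import Relation.Binary.PropositionalEquality

≤-length-filter : ∀ {a p} {A : Set a} {P : Pred A p} (P? : Decidable P) {xs : List A} {C : ℕ}
  (f : Fin C → A) → (∀ i → f i ∈ xs) → (∀ i → P (f i)) → Injective _≡_ _≡_ f
  → C ≤ length (filter P? xs)
≤-length-filter {A = A} P? {xs} {C} f f∈xs Pf f-inj = ℕₚ.≮⇒≥ collision
  where
  ys : List A
  ys = filter P? xs
  f∈ys : ∀ i → f i ∈ ys
  f∈ys i = ∈-filter⁺ P? (f∈xs i) (Pf i)
  position : ∀ i → f i ≡ List.lookup ys (Any.index (f∈ys i))
  position i = lookup-index (f∈ys i)
  collision : ¬ length ys < C
  collision ys<C with i , j , i<j , same ← Finₚ.pigeonhole ys<C (Any.index ∘ f∈ys) =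
    Finₚ.<⇒≢ i<j (f-inj (trans (position i) (trans (cong (List.lookup ys) same) (sym (position j)))))

∈-allVecs : ∀ ℓ M (v : Vec ℕ ℓ) → (∀ i → lookup v i < M) → v ∈ allVecs ℓ M
∈-allVecs zero M [] _ = here refl
∈-allVecs (suc ℓ) M (x ∷ v) v<M =
  ∈-concatMap⁺ (λ i → List.map (i ∷_) (allVecs ℓ M))
    (Any.map (λ { refl → ∈-map⁺ (x ∷_) (∈-allVecs ℓ M v (v<M ∘ Fin.suc)) }) (∈-upTo⁺ (v<M Fin.zero)))

funToFin-cong : ∀ {m n} {f g : Fin m → Fin n} → f ≗ g → funToFin f ≡ funToFin g
funToFin-cong {zero} _ = refl
funToFin-cong {suc m} f≗g = cong₂ combine (f≗g Fin.zero) (funToFin-cong (f≗g ∘ Fin.suc))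

finToFun-injective : ∀ {m n} {i j : Fin (m ^ n)} → finToFun {m} {n} i ≗ finToFun j → i ≡ j
finToFun-injective {m} {n} {i} {j} eq =
  trans (sym (Finₚ.funToFin-finToFin {n} {m} i))
    (trans (funToFin-cong {n} {m} eq) (Finₚ.funToFin-finToFin {n} {m} j))

-- The congruence of Defs unfolds to a divisibility of an absolute value, from which Agda
-- cannot recover x and y; this record version keeps them inferable.
infix 4 _≋_[mod_]
record _≋_[mod_] (x y : ℤ) (m : ℕ) : Set where
  constructor congruent
  field
    ∣-difference : + m ∣ᶻ x - y

open _≋_[mod_]

module _ {m : ℕ} where

  ≋⇒≡[mod] : ∀ {x y} → x ≋ y [mod m ] → x ≡ y [mod m ]
  ≋⇒≡[mod] x≋y = ∣⇒∣ᵤ (∣-difference x≋y)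

  ≋-refl : ∀ {x} → x ≋ x [mod m ]
  ≋-refl {x} = congruent (subst (+ m ∣ᶻ_) (sym (ℤₚ.+-inverseʳ x)) (ℤ∣.divides (+ 0) refl))

  ≋-sym : ∀ {x y} → x ≋ y [mod m ] → y ≋ x [mod m ]
  ≋-sym {x} {y} (congruent m∣x-y) = congruent (subst (+ m ∣ᶻ_) (flip x y) (ℤ∣.∣m⇒∣-m m∣x-y))
    where
    flip : ∀ x y → - (x - y) ≡ y - x
    flip = solve-∀

  ≋-trans : ∀ {x y z} → x ≋ y [mod m ] → y ≋ z [mod m ] → x ≋ z [mod m ]
  ≋-trans {x} {y} {z} (congruent m∣x-y) (congruent m∣y-z) =
    congruent (subst (+ m ∣ᶻ_) (split x y z) (ℤ∣.∣m∣n⇒∣m+n m∣x-y m∣y-z))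
    where
    split : ∀ x y z → (x - y) + (y - z) ≡ x - z
    split = solve-∀

  +-cong-≋ : ∀ {x x′ y y′} → x ≋ x′ [mod m ] → y ≋ y′ [mod m ] → x + y ≋ x′ + y′ [mod m ]
  +-cong-≋ {x} {x′} {y} {y′} (congruent m∣x-x′) (congruent m∣y-y′) =
    congruent (subst (+ m ∣ᶻ_) (split x x′ y y′) (ℤ∣.∣m∣n⇒∣m+n m∣x-x′ m∣y-y′))
    where
    split : ∀ x x′ y y′ → (x - x′) + (y - y′) ≡ (x + y) - (x′ + y′)
    split = solve-∀

  *-cong-≋ : ∀ {x x′ y y′} → x ≋ x′ [mod m ] → y ≋ y′ [mod m ] → x * y ≋ x′ * y′ [mod m ]
  *-cong-≋ {x} {x′} {y} {y′} (congruent m∣x-x′) (congruent m∣y-y′) =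
    congruent (subst (+ m ∣ᶻ_) (split x x′ y y′)
      (ℤ∣.∣m∣n⇒∣m+n (ℤ∣.∣m⇒∣m*n y m∣x-x′) (ℤ∣.∣n⇒∣m*n x′ m∣y-y′)))
    where
    split : ∀ x x′ y y′ → (x - x′) * y + x′ * (y - y′) ≡ x * y - x′ * y′
    split = solve-∀

  +-multiple-≋ : ∀ x {d} → + m ∣ᶻ d → x + d ≋ x [mod m ]
  +-multiple-≋ x {d} m∣d = congruent (subst (+ m ∣ᶻ_) (cancel x d) m∣d)
    where
    cancel : ∀ x d → d ≡ (x + d) - x
    cancel = solve-∀

  ∣-resp-≋ : ∀ {d x y} → d ∣ m → d ∣ ∣ x ∣ → x ≋ y [mod m ] → d ∣ ∣ y ∣
  ∣-resp-≋ {d} {x} {y} d∣m d∣x (congruent m∣x-y) = ∣⇒∣ᵤ {+ d} (subst (+ d ∣ᶻ_) (cancel x y)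
    (ℤ∣.∣m∣n⇒∣m-n (∣ᵤ⇒∣ {+ d} {x} d∣x) (ℤ∣.∣-trans (∣ᵤ⇒∣ {+ d} {+ m} d∣m) m∣x-y)))
    where
    cancel : ∀ x y → x - (x - y) ≡ y
    cancel = solve-∀

  %ℕ-≋ : ∀ x .{{_ : NonZero m}} → + (x %ℕ m) ≋ x [mod m ]
  %ℕ-≋ x = congruent (ℤ∣.divides (- (x /ℕ m))
    (trans (cong (λ y → + (x %ℕ m) - y) (a≡a%ℕn+[a/ℕn]*n x m)) (cancel (+ (x %ℕ m)) (x /ℕ m) (+ m))))
    where
    cancel : ∀ r q m → r - (r + q * m) ≡ - q * m
    cancel = solve-∀

≋-weaken : ∀ {m n x y} → m ∣ n → x ≋ y [mod n ] → x ≋ y [mod m ]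
≋-weaken {m} {n} m∣n (congruent n∣x-y) = congruent (ℤ∣.∣-trans (∣ᵤ⇒∣ {+ m} {+ n} m∣n) n∣x-y)

≋⇒≡ : ∀ {m a b} → a < m → b < m → + a ≋ + b [mod m ] → a ≡ b
≋⇒≡ {m} {a} {b} a<m b<m a≋b with ∣ a ℤ.⊖ b ∣ in eq
... | zero =
  ℤₚ.+-injective (ℤₚ.i-j≡0⇒i≡j (+ a) (+ b) (trans (ℤₚ.[+m]-[+n]≡m⊖n a b) (ℤₚ.∣i∣≡0⇒i≡0 eq)))
... | suc d = contradiction (subst (m ∣_) (trans (cong ∣_∣ (ℤₚ.[+m]-[+n]≡m⊖n a b)) eq) (≋⇒≡[mod] a≋b))
                (>⇒∤ (ℕₚ.≤-<-trans (subst (_≤ a ⊔ b) eq (ℤₚ.∣m⊝n∣≤m⊔n a b)) (ℕₚ.⊔-lub a<m b<m)))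

^-monoʳ-∣ : ∀ p {m n} → m ≤ n → p ^ m ∣ p ^ n
^-monoʳ-∣ p {m} {n} m≤n =
  divides (p ^ (n ∸ m)) (trans (cong (p ^_) (sym (ℕₚ.m∸n+n≡m m≤n))) (ℕₚ.^-distribˡ-+-* p (n ∸ m) m))

p∣p^n : ∀ p {n} → 1 ≤ n → p ∣ p ^ n
p∣p^n p {n} 1≤n = subst (_∣ p ^ n) (ℕₚ.*-identityʳ p) (^-monoʳ-∣ p 1≤n)

pos-^-distribˡ-+ : ∀ p m n → + (p ^ (m ℕ.+ n)) ≡ + (p ^ m) * + (p ^ n)
pos-^-distribˡ-+ p m n = trans (cong +_ (ℕₚ.^-distribˡ-+-* p m n)) (ℤₚ.pos-* (p ^ m) (p ^ n))

+-*-cancel-≋ : ∀ {M n} .{{_ : NonZero M}} u t t′ → u + + M * t ≋ u + + M * t′ [mod M ℕ.* n ] → t ≋ t′ [mod n ]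
+-*-cancel-≋ {M} {n} u t t′ (congruent Mn∣difference) =
  congruent (ℤ∣.*-cancelˡ-∣ (+ M) (subst₂ _∣ᶻ_ (ℤₚ.pos-* M n) (factor u t t′ (+ M)) Mn∣difference))
  where
  factor : ∀ u t t′ M → (u + M * t) - (u + M * t′) ≡ M * (t - t′)
  factor = solve-∀

-- Finite sums and the diagonal form

sumFin-cong-≋ : ∀ {m} n {f g : Fin n → ℤ} → (∀ i → f i ≋ g i [mod m ]) → sumFin n f ≋ sumFin n g [mod m ]
sumFin-cong-≋ zero _ = ≋-refl
sumFin-cong-≋ (suc n) f≋g = +-cong-≋ (f≋g Fin.zero) (sumFin-cong-≋ n (f≋g ∘ Fin.suc))

Qform-cong-≋ : ∀ {m ℓ} (a : Fin ℓ → ℤ) {x y : Fin ℓ → ℤ} → (∀ i → x i ≋ y i [mod m ])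
  → Qform a x ≋ Qform a y [mod m ]
Qform-cong-≋ {ℓ = ℓ} a x≋y =
  sumFin-cong-≋ ℓ (λ i → *-cong-≋ (≋-refl {x = a i}) (*-cong-≋ (x≋y i) (x≋y i)))

sumFin-linear : ∀ n (K : ℤ) {f g h : Fin n → ℤ} → (∀ i → f i ≡ g i + K * h i)
  → sumFin n f ≡ sumFin n g + K * sumFin n h
sumFin-linear zero K _ = sym (trans (ℤₚ.+-identityˡ (K * + 0)) (ℤₚ.*-zeroʳ K))
sumFin-linear (suc n) K {f} {g} {h} f≡g+Kh = begin
  f Fin.zero + sumFin n (f ∘ Fin.suc)
    ≡⟨ cong₂ _+_ (f≡g+Kh Fin.zero) (sumFin-linear n K (f≡g+Kh ∘ Fin.suc)) ⟩
  (g Fin.zero + K * h Fin.zero) + (sumFin n (g ∘ Fin.suc) + K * sumFin n (h ∘ Fin.suc))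
    ≡⟨ regroup (g Fin.zero) (h Fin.zero) (sumFin n (g ∘ Fin.suc)) (sumFin n (h ∘ Fin.suc)) K ⟩
  (g Fin.zero + sumFin n (g ∘ Fin.suc)) + K * (h Fin.zero + sumFin n (h ∘ Fin.suc)) ∎
  where
  open ≡-Reasoning
  regroup : ∀ a b c d K → (a + K * b) + (c + K * d) ≡ (a + c) + K * (b + d)
  regroup = solve-∀

sumFin-insertAt : ∀ {L} (h : Fin (suc L) → ℤ → ℤ) (t : Fin L → ℤ) (j : Fin (suc L)) (s : ℤ)
  → sumFin (suc L) (λ i → h i (insertAt t j s i)) ≡ h j s + sumFin L (λ i → h (punchIn j i) (t i))
sumFin-insertAt h t Fin.zero s = refl
sumFin-insertAt {suc L} h t (Fin.suc j) s =
  trans (cong (λ w → h Fin.zero (t Fin.zero) + w) (sumFin-insertAt (h ∘ Fin.suc) (t ∘ Fin.suc) j s))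
        (swap (h Fin.zero (t Fin.zero)) (h (Fin.suc j) s) (sumFin L (λ i → h (Fin.suc (punchIn j i)) (t (Fin.suc i)))))
  where
  swap : ∀ a b c → a + (b + c) ≡ b + (a + c)
  swap = solve-∀

Qform-shift : ∀ {ℓ} (a u c t : Fin ℓ → ℤ) {G H M : ℤ} → M ≡ G * H → (∀ i → a i * u i ≡ c i * G)
  → Qform a (λ i → u i + M * t i) ≡ Qform a u + M * G * sumFin ℓ (λ i → + 2 * c i * t i + H * a i * (t i * t i))
Qform-shift {ℓ} a u c t {G} {H} refl au≡cG =
  sumFin-linear ℓ (G * H * G) (λ i → square-shift (a i) (u i) (c i) (t i) (au≡cG i))
  where
  square-shift : ∀ A U C T → A * U ≡ C * G
    → A * ((U + G * H * T) * (U + G * H * T)) ≡ A * (U * U) + G * H * G * (+ 2 * C * T + H * A * (T * T))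
  square-shift A U C T AU≡CG = begin
    A * ((U + G * H * T) * (U + G * H * T))
      ≡⟨ expand A U T G H ⟩
    A * (U * U) + G * H * (+ 2 * (A * U) * T) + G * H * G * (H * A * (T * T))
      ≡⟨ cong (λ w → A * (U * U) + G * H * (+ 2 * w * T) + G * H * G * (H * A * (T * T))) AU≡CG ⟩
    A * (U * U) + G * H * (+ 2 * (C * G) * T) + G * H * G * (H * A * (T * T))
      ≡⟨ collect A U C T G H ⟩
    A * (U * U) + G * H * G * (+ 2 * C * T + H * A * (T * T)) ∎
    where
    open ≡-Reasoning
    expand : ∀ A U T G H → A * ((U + G * H * T) * (U + G * H * T))
                         ≡ A * (U * U) + G * H * (+ 2 * (A * U) * T) + G * H * G * (H * A * (T * T))
    expand = solve-∀
    collect : ∀ A U C T G H → A * (U * U) + G * H * (+ 2 * (C * G) * T) + G * H * G * (H * A * (T * T))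
                            ≡ A * (U * U) + G * H * G * (+ 2 * C * T + H * A * (T * T))
    collect = solve-∀

-- Valuations at a prime

ordAux-maximal : ∀ q fuel n → 1 ≤ n → n ≤ fuel → ¬ suc (suc q) ^ suc (ordAux fuel (suc (suc q)) n) ∣ n
ordAux-maximal q (suc fuel) (suc n) _ n≤fuel p^[1+o]∣n with suc (suc q) ∣? suc n
... | no p∤n = p∤n (subst (_∣ suc n) (ℕₚ.*-identityʳ (suc (suc q))) p^[1+o]∣n)
... | yes p∣n = ordAux-maximal q fuel (suc n / p) (m≥n⇒m/n>0 (∣⇒≤ p∣n))
      (ℕₚ.≤-pred (ℕₚ.≤-trans (m/n<m (suc n) p (s≤s (s≤s z≤n))) n≤fuel))
      (*-cancelˡ-∣ p (subst (p ℕ.* p ^ suc (ordAux fuel p (suc n / p)) ∣_) (sym (m*[n/m]≡n p∣n)) p^[1+o]∣n))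
  where
  p : ℕ
  p = suc (suc q)

p^[1+ord]∤ : ∀ {p} → Prime p → ∀ {x} → ¬ x ≡ + 0 → ¬ p ^ suc (ord p x) ∣ ∣ x ∣
p^[1+ord]∤ {zero} p-prime = contradiction p-prime ¬prime[0]
p^[1+ord]∤ {suc zero} p-prime = contradiction p-prime ¬prime[1]
p^[1+ord]∤ {suc (suc q)} _ {+ zero} x≢0 = contradiction refl x≢0
p^[1+ord]∤ {suc (suc q)} _ {+ suc n} _ = ordAux-maximal q (suc n) (suc n) (s≤s z≤n) ℕₚ.≤-refl
p^[1+ord]∤ {suc (suc q)} _ { -[1+ n ]} _ = ordAux-maximal q (suc n) (suc n) (s≤s z≤n) ℕₚ.≤-refl

pos-1+m*n≡o*k : ∀ m n o k → 1 ℕ.+ m ℕ.* n ≡ o ℕ.* k → + 1 + + m * + n ≡ + o * + k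
pos-1+m*n≡o*k m n o k eq =
  trans (cong (λ w → + 1 + w) (sym (ℤₚ.pos-* m n))) (trans (cong +_ eq) (ℤₚ.pos-* o k))

quadratic : ℤ → ℤ → ℤ → ℤ → ℤ
quadratic α β γ s = α * s + β * (s * s) + γ

∤∧∣⇒∤+ : ∀ {d} x {y} → ¬ d ∣ ∣ x ∣ → + d ∣ᶻ y → ¬ d ∣ ∣ x + y ∣
∤∧∣⇒∤+ {d} x {y} d∤x d∣y d∣x+y =
  d∤x (∣⇒∣ᵤ {+ d} {x} (ℤ∣.∣m+n∣n⇒∣m (∣ᵤ⇒∣ {+ d} {x + y} d∣x+y) d∣y))

-- A Newton step: z inverts f′(s) = α + 2βs modulo p.
quadratic-lift : ∀ {p} α β γ s P q z → + p ∣ᶻ β → z * (α + + 2 * β * s) ≋ + 1 [mod p ]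
  → quadratic α β γ s ≡ q * P → + p * P ∣ᶻ quadratic α β γ (s + P * - (q * z))
quadratic-lift {p} α β γ s P q z (ℤ∣.divides b β≡bp) zδ≋1 f≡qP
  with ℤ∣.divides w 1-zδ≡wp ← ∣-difference (≋-sym zδ≋1) = ℤ∣.divides (q * w + b * (P * (t * t))) (begin
    quadratic α β γ (s + P * t)
      ≡⟨ expand α β γ s P t ⟩
    quadratic α β γ s + P * t * δ + β * (P * (P * (t * t)))
      ≡⟨ cong₂ (λ f β → f + P * t * δ + β * (P * (P * (t * t)))) f≡qP β≡bp ⟩
    q * P + P * t * δ + b * + p * (P * (P * (t * t)))
      ≡⟨ cong (_+ b * + p * (P * (P * (t * t)))) (factor q P z δ) ⟩
    P * q * (+ 1 - z * δ) + b * + p * (P * (P * (t * t)))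
      ≡⟨ cong (λ e → P * q * e + b * + p * (P * (P * (t * t)))) 1-zδ≡wp ⟩
    P * q * (w * + p) + b * + p * (P * (P * (t * t)))
      ≡⟨ collect P q w (+ p) b (t * t) ⟩
    (q * w + b * (P * (t * t))) * (+ p * P) ∎)
  where
  open ≡-Reasoning
  t δ : ℤ
  t = - (q * z)
  δ = α + + 2 * β * s
  expand : ∀ α β γ s P t → α * (s + P * t) + β * ((s + P * t) * (s + P * t)) + γ
                          ≡ (α * s + β * (s * s) + γ) + P * t * (α + + 2 * β * s) + β * (P * (P * (t * t)))
  expand = solve-∀
  factor : ∀ q P z δ → q * P + P * - (q * z) * δ ≡ P * q * (+ 1 - z * δ)
  factor = solve-∀
  collect : ∀ P q w p b tt → P * q * (w * p) + b * p * (P * (P * tt)) ≡ (q * w + b * (P * tt)) * (p * P)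
  collect = solve-∀

module _ {p : ℕ} (p-prime : Prime p) where

  private instance
    p≢0 : NonZero p
    p≢0 = prime⇒nonZero p-prime

  p^e∣m*n∧p∤n⇒p^e∣m : ∀ e m {n} → ¬ p ∣ n → p ^ e ∣ m ℕ.* n → p ^ e ∣ m
  p^e∣m*n∧p∤n⇒p^e∣m zero m _ _ = 1∣ m
  p^e∣m*n∧p∤n⇒p^e∣m (suc e) m {n} p∤n p^[1+e]∣mn
    with euclidsLemma m n p-prime (∣-trans (m∣m*n (p ^ e)) p^[1+e]∣mn)
  ... | inj₂ p∣n = contradiction p∣n p∤n
  ... | inj₁ (divides m′ refl) = subst (_∣ m′ ℕ.* p) (ℕₚ.*-comm (p ^ e) p)
        (*-monoˡ-∣ p (p^e∣m*n∧p∤n⇒p^e∣m e m′ p∤n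
          (*-cancelˡ-∣ p (subst (p ℕ.* p ^ e ∣_) (regroup m′) p^[1+e]∣mn))))
    where
    regroup : ∀ m′ → m′ ℕ.* p ℕ.* n ≡ p ℕ.* (m′ ℕ.* n)
    regroup m′ = trans (ℕₚ.*-assoc m′ p n) (trans (cong (m′ ℕ.*_) (ℕₚ.*-comm p n))
                   (trans (sym (ℕₚ.*-assoc m′ n p)) (ℕₚ.*-comm (m′ ℕ.* n) p)))

  p^[1+ord]∤*unit : ∀ {x y} → ¬ x ≡ + 0 → ¬ p ∣ ∣ y ∣ → ¬ p ^ suc (ord p x) ∣ ∣ x * y ∣
  p^[1+ord]∤*unit {x} {y} x≢0 p∤y p^[1+o]∣xy = p^[1+ord]∤ p-prime x≢0
    (p^e∣m*n∧p∤n⇒p^e∣m (suc (ord p x)) ∣ x ∣ p∤y (subst (p ^ suc (ord p x) ∣_) (ℤₚ.abs-* x y) p^[1+o]∣xy))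

  ∤⇒coprime : ∀ {n} → ¬ p ∣ n → Coprime p n
  ∤⇒coprime p∤n {d} (d∣p , d∣n) with prime⇒irreducible p-prime d∣p
  ... | inj₁ d≡1 = d≡1
  ... | inj₂ refl = contradiction d∣n p∤n

  ∃-inverse-modℕ : ∀ {n} → ¬ p ∣ n → ∃ λ z → z * + n ≋ + 1 [mod p ]
  ∃-inverse-modℕ {n} p∤n with coprime-Bézout (∤⇒coprime p∤n)
  ... | Bézout.+- x y 1+yn≡xp = - + y , congruent (ℤ∣.divides (- + x) (begin
    - + y * + n - + 1 ≡⟨ negate (+ y) (+ n) ⟩
    - (+ 1 + + y * + n) ≡⟨ cong -_ (pos-1+m*n≡o*k y n x p 1+yn≡xp) ⟩
    - (+ x * + p) ≡⟨ ℤₚ.neg-distribˡ-* (+ x) (+ p) ⟩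
    - + x * + p ∎))
    where
    open ≡-Reasoning
    negate : ∀ y n → - y * n - + 1 ≡ - (+ 1 + y * n)
    negate = solve-∀
  ... | Bézout.-+ x y 1+xp≡yn = + y , congruent (ℤ∣.divides (+ x) (begin
    + y * + n - + 1 ≡⟨ cong (_- + 1) (pos-1+m*n≡o*k x p y n 1+xp≡yn) ⟨
    + 1 + + x * + p - + 1 ≡⟨ cancel (+ x * + p) ⟩
    + x * + p ∎))
    where
    open ≡-Reasoning
    cancel : ∀ w → + 1 + w - + 1 ≡ w
    cancel = solve-∀

  ∃-inverse-mod : ∀ δ → ¬ p ∣ ∣ δ ∣ → ∃ λ z → z * δ ≋ + 1 [mod p ]
  ∃-inverse-mod (+ n) p∤n = ∃-inverse-modℕ p∤n
  ∃-inverse-mod -[1+ n ] p∤n with z , z*n≋1 ← ∃-inverse-modℕ p∤n =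
    - z , subst (_≋ + 1 [mod p ]) (negate z (+ suc n)) z*n≋1
    where
    negate : ∀ z n → z * n ≡ - z * - n
    negate = solve-∀

  p≢2⇒p∤2*n : ¬ p ≡ 2 → ∀ w → ¬ p ∣ ∣ w ∣ → ¬ p ∣ ∣ + 2 * w ∣
  p≢2⇒p∤2*n p≢2 w p∤w p∣2w with euclidsLemma 2 ∣ w ∣ p-prime (subst (p ∣_) (ℤₚ.abs-* (+ 2) w) p∣2w)
  ... | inj₂ p∣w = p∤w p∣w
  ... | inj₁ p∣2 with irreducible[2] p∣2
  ...   | inj₁ refl = ¬prime[1] p-prime
  ...   | inj₂ p≡2 = p≢2 p≡2

  quadratic-hensel : ∀ n {α β} γ → ¬ p ∣ ∣ α ∣ → + p ∣ᶻ β → ∃ λ s → + (p ^ n) ∣ᶻ quadratic α β γ s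
  quadratic-hensel zero {α} {β} γ _ _ = + 0 , ℤ∣.divides (quadratic α β γ (+ 0)) (sym (ℤₚ.*-identityʳ _))
  quadratic-hensel (suc n) {α} {β} γ p∤α p∣β
    with s , ℤ∣.divides q f≡qP ← quadratic-hensel n {α} {β} γ p∤α p∣β
    with z , zδ≋1 ← ∃-inverse-mod (α + + 2 * β * s)
                      (∤∧∣⇒∤+ α p∤α (ℤ∣.∣m⇒∣m*n s (ℤ∣.∣n⇒∣m*n (+ 2) p∣β)))
    = s + P * - (q * z) , subst (_∣ᶻ quadratic α β γ (s + P * - (q * z))) (sym (ℤₚ.pos-* p (p ^ n)))
                             (quadratic-lift α β γ s P q z p∣β zδ≋1 f≡qP)
    where
    P : ℤ
    P = + (p ^ n)

-- The depth and the minimal valuation of the aᵢ uᵢ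

foldr-⊓-∈ : ∀ x xs → List.foldr _⊓_ x xs ∈ x ∷ xs
foldr-⊓-∈ x [] = here refl
foldr-⊓-∈ x (y ∷ ys) with ℕₚ.⊓-sel y (List.foldr _⊓_ x ys)
... | inj₁ m≡y = there (here m≡y)
... | inj₂ m≡rest with foldr-⊓-∈ x ys
...   | here rest≡x = here (trans m≡rest rest≡x)
...   | there rest∈ys = there (there (subst (_∈ ys) (sym m≡rest) rest∈ys))

minimum-∈ : ∀ {xs y} → y ∈ xs → minimum xs ∈ xs
minimum-∈ {x ∷ xs} _ = foldr-⊓-∈ x xs

module _ {p : ℕ} (p-prime : Prime p) {ℓ : ℕ} (a u : Fin ℓ → ℤ) (u-primitive : Primitive u) where

  ∃-unit : ∃ λ j → ¬ p ∣ ∣ u j ∣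
  ∃-unit = Finₚ.¬∀⟶∃¬ ℓ _ (λ j → p ∣? ∣ u j ∣)
    (λ p∣u → ¬prime[1] (subst Prime (u-primitive p p∣u) p-prime))

  private
    level : Fin ℓ → ℕ
    level j = suc (ord p (a j))

    unit? : Decidable (λ j → ¬ p ∣ ∣ u j ∣)
    unit? j = ¬? (p ∣? ∣ u j ∣)

  ∃-unit-attaining-depth : ∃ λ j → ¬ p ∣ ∣ u j ∣ × suc (ord p (a j)) ≡ depth a u p
  ∃-unit-attaining-depth
    with j₁ , p∤uj₁ ← ∃-unit
    with j , depth∈ , depth≡ ←
           ∈-map⁻ level (minimum-∈ (∈-map⁺ level (∈-filter⁺ unit? (∈-allFin j₁) p∤uj₁)))
    = j , proj₂ (∈-filter⁻ unit? {xs = allFinList ℓ} depth∈) , sym depth≡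

∃-minimal-valuation : ∀ {ℓ} d (b : Fin ℓ → ℕ) B j → ¬ d ^ suc B ∣ b j
  → ∃₂ λ g i → g ≤ B × (∀ k → d ^ g ∣ b k) × ¬ d ^ suc g ∣ b i
∃-minimal-valuation d b zero j d∤bj = 0 , j , z≤n , (λ k → 1∣ b k) , d∤bj
∃-minimal-valuation {ℓ} d b (suc B) j d^[2+B]∤bj with Finₚ.all? (λ k → d ^ suc B ∣? b k)
... | yes d^[1+B]∣b = suc B , j , ℕₚ.≤-refl , d^[1+B]∣b , d^[2+B]∤bj
... | no ¬d^[1+B]∣b
  with i , d^[1+B]∤bi ← Finₚ.¬∀⟶∃¬ ℓ _ (λ k → d ^ suc B ∣? b k) ¬d^[1+B]∣b
  with g , i′ , g≤B , d^g∣b , d^[1+g]∤bi′ ← ∃-minimal-valuation d b B i d^[1+B]∤bi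
  = g , i′ , ℕₚ.m≤n⇒m≤1+n g≤B , d^g∣b , d^[1+g]∤bi′

-- Counting lifts

incongruent-lifts≤N : ∀ {ℓ C} (a u : Fin ℓ → ℤ) {p k r m : ℕ} {j₀ : Fin ℓ} .{{_ : NonZero p}}
  → 1 ≤ m → r ≤ m → m ≤ k → ¬ p ∣ ∣ u j₀ ∣
  → (x : Fin C → Fin ℓ → ℤ)
  → (∀ q i → x q i ≋ u i [mod p ^ m ])
  → (∀ q → Qform a (x q) ≋ Qform a u [mod p ^ k ])
  → (∀ q q′ → (∀ i → x q i ≋ x q′ i [mod p ^ k ]) → q ≡ q′)
  → C ≤ N a u r p k
incongruent-lifts≤N {ℓ} {C} a u {p} {k} {r} {m} {j₀} 1≤m r≤m m≤k p∤uj₀ x x≋u Qx≋Qu x-incongruent =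
  ≤-length-filter (cond? a u p k r) reduce reduce∈ reduce-satisfies reduce-injective
  where
  instance
    p^k≢0 : NonZero (p ^ k)
    p^k≢0 = ℕₚ.m^n≢0 p k

  reduce : Fin C → Vec ℕ ℓ
  reduce q = tabulate (λ i → x q i %ℕ p ^ k)

  lookup-reduce : ∀ q i → lookup (reduce q) i ≡ x q i %ℕ p ^ k
  lookup-reduce q i = Vecₚ.lookup∘tabulate (λ i → x q i %ℕ p ^ k) i

  reduce≋x : ∀ q i → toZ (reduce q) i ≋ x q i [mod p ^ k ]
  reduce≋x q i = subst (λ v → + v ≋ x q i [mod p ^ k ]) (sym (lookup-reduce q i)) (%ℕ-≋ (x q i))

  reduce≋u : ∀ q i → toZ (reduce q) i ≋ u i [mod p ^ m ]
  reduce≋u q i = ≋-trans (≋-weaken (^-monoʳ-∣ p m≤k) (reduce≋x q i)) (x≋u q i)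

  reduce∈ : ∀ q → reduce q ∈ allVecs ℓ (p ^ k)
  reduce∈ q = ∈-allVecs ℓ (p ^ k) (reduce q)
    (λ i → subst (_< p ^ k) (sym (lookup-reduce q i)) (n%ℕd<d (x q i) (p ^ k)))

  reduce-satisfies : ∀ q → Cond a u p k r (reduce q)
  reduce-satisfies q =
    (j₀ , λ p∣reduce → p∤uj₀ (∣-resp-≋ (p∣p^n p 1≤m) p∣reduce (reduce≋u q j₀))) ,
    ≋⇒≡[mod] (≋-trans (Qform-cong-≋ a (reduce≋x q)) (Qx≋Qu q)) ,
    (λ i → ≋⇒≡[mod] (≋-weaken (^-monoʳ-∣ p r≤m) (reduce≋u q i)))

  reduce-injective : Injective _≡_ _≡_ reduce
  reduce-injective {q} {q′} same = x-incongruent q q′ λ i →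
    ≋-trans (≋-sym (reduce≋x q i)) (subst (λ v → toZ v i ≋ x q′ i [mod p ^ k ]) (sym same) (reduce≋x q′ i))

-- Lifts u + p^m t whose coordinates other than j are free digits modulo p^(k-m)
-- and whose j-th coordinate is chosen by Hensel's lemma.
module Lifting {p : ℕ} (p-prime : Prime p) (p≢2 : ¬ p ≡ 2) {L : ℕ} (a u : Fin (suc L) → ℤ)
  {g m k : ℕ} (g<m : g < m) (m≤k : m ≤ k) (j : Fin (suc L))
  (p^g∣au : ∀ i → p ^ g ∣ ∣ a i * u i ∣) (p^[1+g]∤auj : ¬ p ^ suc g ∣ ∣ a j * u j ∣) where

  private instance
    p≢0 : NonZero p
    p≢0 = prime⇒nonZero p-prime

  P : ℕ → ℤ
  P n = + (p ^ n)

  e E : ℕ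
  e = m ∸ g
  E = k ∸ m

  c : Fin (suc L) → ℤ
  c i = ℤ∣._∣_.quotient (∣ᵤ⇒∣ {P g} {a i * u i} (p^g∣au i))

  au≡cP : ∀ i → a i * u i ≡ c i * P g
  au≡cP i = ℤ∣._∣_.equality (∣ᵤ⇒∣ {P g} {a i * u i} (p^g∣au i))

  p∤cj : ¬ p ∣ ∣ c j ∣
  p∤cj p∣cj = p^[1+g]∤auj (subst (p ^ suc g ∣_)
    (sym (trans (cong ∣_∣ (au≡cP j)) (ℤₚ.abs-* (c j) (P g)))) (*-monoˡ-∣ (p ^ g) p∣cj))

  term : Fin (suc L) → ℤ → ℤ
  term i τ = + 2 * c i * τ + P e * a i * (τ * τ)

  digits : Fin ((p ^ E) ^ L) → Fin L → ℤ
  digits q i = + toℕ (finToFun q i)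

  rest : Fin ((p ^ E) ^ L) → ℤ
  rest q = sumFin L (λ i → term (punchIn j i) (digits q i))

  root : ∀ q → ∃ λ s → P (k ∸ (m ℕ.+ g)) ∣ᶻ quadratic (+ 2 * c j) (P e * a j) (rest q) s
  root q = quadratic-hensel p-prime (k ∸ (m ℕ.+ g)) {+ 2 * c j} (rest q) (p≢2⇒p∤2*n p-prime p≢2 (c j) p∤cj)
    (ℤ∣.∣m⇒∣m*n (a j) (∣ᵤ⇒∣ {+ p} {P e} (p∣p^n p (ℕₚ.m<n⇒0<n∸m g<m))))

  t : Fin ((p ^ E) ^ L) → Fin (suc L) → ℤ
  t q = insertAt (digits q) j (proj₁ (root q))

  lift : Fin ((p ^ E) ^ L) → Fin (suc L) → ℤ
  lift q i = u i + P m * t q i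

  Pm≡PgPe : P m ≡ P g * P e
  Pm≡PgPe = trans (cong P (sym (ℕₚ.m+[n∸m]≡n (ℕₚ.<⇒≤ g<m)))) (pos-^-distribˡ-+ p g e)

  lift≋u : ∀ q i → lift q i ≋ u i [mod p ^ m ]
  lift≋u q i = +-multiple-≋ (u i) (ℤ∣.∣m⇒∣m*n (t q i) ℤ∣.∣-refl)

  Qform-lift : ∀ q → Qform a (lift q) ≋ Qform a u [mod p ^ k ]
  Qform-lift q = subst (_≋ Qform a u [mod p ^ k ]) (sym expansion)
    (+-multiple-≋ (Qform a u) (ℤ∣.∣-trans Pk∣PmPgPn (ℤ∣.*-monoʳ-∣ (P m * P g) (proj₂ (root q)))))
    where
    Pk∣PmPgPn : P k ∣ᶻ P m * P g * P (k ∸ (m ℕ.+ g))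
    Pk∣PmPgPn = subst (P k ∣ᶻ_) (trans (pos-^-distribˡ-+ p (m ℕ.+ g) n) (cong (_* P n) (pos-^-distribˡ-+ p m g)))
      (∣ᵤ⇒∣ {P k} {P (m ℕ.+ g ℕ.+ n)} (^-monoʳ-∣ p (ℕₚ.m≤n+m∸n k (m ℕ.+ g))))
      where
      n : ℕ
      n = k ∸ (m ℕ.+ g)
    expansion : Qform a (lift q) ≡ Qform a u + P m * P g * quadratic (+ 2 * c j) (P e * a j) (rest q) (proj₁ (root q))
    expansion = trans (Qform-shift a u c (t q) Pm≡PgPe au≡cP)
      (cong (λ S → Qform a u + P m * P g * S) (sumFin-insertAt term (digits q) j (proj₁ (root q))))

  lift-injective : ∀ q q′ → (∀ i → lift q i ≋ lift q′ i [mod p ^ k ]) → q ≡ q′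
  lift-injective q q′ lift≋lift = finToFun-injective λ i → Finₚ.toℕ-injective
    (≋⇒≡ (Finₚ.toℕ<n (finToFun q i)) (Finₚ.toℕ<n (finToFun q′ i)) (digits≋ i))
    where
    digits≋ : ∀ i → digits q i ≋ digits q′ i [mod p ^ E ]
    digits≋ i = +-*-cancel-≋ {p ^ m} {{ℕₚ.m^n≢0 p m}} (u I) (digits q i) (digits q′ i)
      (subst₂ (λ d d′ → u I + P m * d ≋ u I + P m * d′ [mod p ^ m ℕ.* p ^ E ])
        (insertAt-punchIn (digits q) j _ i) (insertAt-punchIn (digits q′) j _ i)
        (subst (λ M → lift q I ≋ lift q′ I [mod M ]) p^k≡p^m*p^E (lift≋lift I)))
      where
      I : Fin (suc L)
      I = punchIn j i
      p^k≡p^m*p^E : p ^ k ≡ p ^ m ℕ.* p ^ E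
      p^k≡p^m*p^E = trans (cong (p ^_) (sym (ℕₚ.m+[n∸m]≡n m≤k))) (ℕₚ.^-distribˡ-+-* p m E)

lemma6p3 : (ℓ : ℕ) (a : Fin ℓ → ℤ) → ((j : Fin ℓ) → ¬ (a j ≡ + 0))
    → (u : Fin ℓ → ℤ) → Primitive u → ¬ (Qform a u ≡ + 0)
    → (k r p : ℕ) → Prime p → ¬ (p ≡ 2)
    → depth a u p ⊔ r ≤ k
    → p ^ ((ℓ ∸ 1) ℕ.* (k ∸ (depth a u p ⊔ r))) ≤ N a u r p k
lemma6p3 zero a _ u _ Qu≢0 _ _ _ _ _ _ = contradiction refl Qu≢0
lemma6p3 (suc L) a a≢0 u u-primitive _ k r p p-prime p≢2 m≤k
  with j₀ , p∤uj₀ , 1+ord≡depth ← ∃-unit-attaining-depth p-prime a u u-primitive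
  with g , j , g≤ord , p^g∣au , p^[1+g]∤auj ← ∃-minimal-valuation p (λ i → ∣ a i * u i ∣) (ord p (a j₀)) j₀
         (p^[1+ord]∤*unit p-prime (a≢0 j₀) p∤uj₀)
  = subst (_≤ N a u r p k) count≡
      (incongruent-lifts≤N a u {{prime⇒nonZero p-prime}} (ℕₚ.≤-trans (s≤s z≤n) g<m) (ℕₚ.m≤n⊔m (depth a u p) r)
        m≤k p∤uj₀ lift lift≋u Qform-lift lift-injective)
  where
  g<m : g < depth a u p ⊔ r
  g<m = ℕₚ.≤-trans (s≤s g≤ord) (subst (_≤ depth a u p ⊔ r) (sym 1+ord≡depth) (ℕₚ.m≤m⊔n _ r))
  open Lifting p-prime p≢2 a u g<m m≤k j p^g∣au p^[1+g]∤auj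
  count≡ : (p ^ E) ^ L ≡ p ^ (L ℕ.* E)
  count≡ = trans (ℕₚ.^-*-assoc p E L) (cong (p ^_) (ℕₚ.*-comm E L))
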